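{- Let $k\ge 0$ be an integer. The number of nice order ideals of the poset $M_{2k+1,2k+3}$ equals $\displaystyle\sum_{i=0}^{k}\frac{1}{i+1}\binom{2i}{i}\binom{2k-2i}{k-i}$.
   Context: For coprime positive integers $s,t$, let $P_{s,t}=\mathbb{N}^+\setminus\{k_1s+k_2t\mid k_1,k_2\in\mathbb{N}\}$ (with $\mathbb N=\{0,1,2,\dots\}$), partially ordered by the reflexive-transitive closure of the cover relation: $x$ covers $y$ (for $x,y\in P_{s,t}$) iff $x-y\in\{s,t\}$. An order ideal of a poset is a subset $I$ such that $y\in I$ and $x\preceq y$ imply $x\in I$. An order ideal $I$ of a poset whose elements are integers is nice if there are no $x,y\in I$ with $x-y=1$. $M_{2k+1,2k+3}$ is the subposet of $P_{2k+1,2k+3}$ obtained by removing all elements $y$ with $y\succeq 2k+2$ (with the induced order). -}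

module Defs where

open import Data.Nat using (ℕ; zero; suc; _+_; _*_; _∸_; _/_)
open import Data.Nat.ListAction using (sum)
open import Data.Nat.Combinatorics using (_C_)
open import Data.Fin using (Fin; toℕ)
open import Data.Fin.Subset using (Subset) renaming (_∈_ to _∈ₛ_)
open import Data.List using (List; map; upTo; length)
open import Data.List.Membership.Propositional using (_∈_)
open import Data.List.Relation.Unary.Unique.Propositional using (Unique)
open import Data.Product using (Σ; ∃; ∃-syntax; _×_)
open import Data.Sum using (_⊎_)
open import Relation.Nullary using (¬_)
open import Relation.Binary.PropositionalEquality using (_≡_)
open import Relation.Binary.Construct.Closure.ReflexiveTransitive using (Star)
open import Function.Bundles using (_⇔_)

InSemigroup : ℕ → ℕ → ℕ → Set
InSemigroup s t n = ∃[ k₁ ] ∃[ k₂ ] (n ≡ k₁ * s + k₂ * t)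

InP : ℕ → ℕ → ℕ → Set
InP s t n = (¬ (n ≡ 0)) × ¬ InSemigroup s t n

Cover : ℕ → ℕ → ℕ → ℕ → Set
Cover s t y x = InP s t y × InP s t x × (x ≡ y + s ⊎ x ≡ y + t)

Leq : ℕ → ℕ → ℕ → ℕ → Set
Leq s t = Star (Cover s t)

sM : ℕ → ℕ
sM k = 2 * k + 1

tM : ℕ → ℕ
tM k = 2 * k + 3

InM : ℕ → ℕ → Set
InM k y = InP (sM k) (tM k) y × ¬ Leq (sM k) (tM k) (2 * k + 2) y

LeqM : ℕ → ℕ → ℕ → Set
LeqM k = Leq (sM k) (tM k)

-- all elements of P_{s,t} are < s*t, so subsets of M are encoded as
-- subsets of Fin (s*t), element i standing for the natural number toℕ i
Bound : ℕ → ℕ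
Bound k = sM k * tM k

MemI : ∀ {N} → Subset N → ℕ → Set
MemI {N} I x = Σ (Fin N) λ i → (toℕ i ≡ x) × (i ∈ₛ I)

IsOrderIdealM : (k : ℕ) → Subset (Bound k) → Set
IsOrderIdealM k I =
  (∀ x → MemI I x → InM k x) ×
  (∀ x y → MemI I y → InM k x → LeqM k x y → MemI I x)

IsNice : ∀ {N} → Subset N → Set
IsNice I = ∀ x y → MemI I x → MemI I y → ¬ (x ≡ y + 1)

IsNiceOrderIdealM : (k : ℕ) → Subset (Bound k) → Set
IsNiceOrderIdealM k I = IsOrderIdealM k I × IsNice I

HasCount : ∀ {N} → (Subset N → Set) → ℕ → Set
HasCount {N} P c = Σ (List (Subset N)) λ L →
  Unique L × (∀ I → (I ∈ L) ⇔ P I) × (length L ≡ c)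

-- Catalan number C_i = binom(2i,i)/(i+1) (exact division)
catalan : ℕ → ℕ
catalan i = ((2 * i) C i) / suc i

formula : ℕ → ℕ
formula k = sum (map (λ i → catalan i * ((2 * (k ∸ i)) C (k ∸ i))) (upTo (suc k)))

-- Write W = 2k + 2, so that s = W - 1 and t = W + 1. The elements of M are the
-- numbers r·W + j with r < j and j + r ≤ 2k, and the elements covering the one
-- at (r, j) sit at (r + 1, j - 1) and (r + 1, j + 1). Being a nice order ideal
-- then forces column j of an ideal, {r | r·W + j ∈ I}, to be {h_j - 1, h_j - 3, …}
-- for a sequence of heights 0 = h_0, h_1, …, h_{2k+1} = 0 with steps ±1, where a
-- down-step from 0 stays at 0; conversely every such walk comes from exactly one
-- nice ideal. Cutting a walk at its first down-step from 0, taken at an even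
-- time 2i, leaves a Dyck path of length 2i, counted by the Catalan number C_i,
-- and a walk of length 2(k - i), counted by the binomial coefficient
-- (2(k - i) choose k - i).

module Submission where

open import Defs
open import Data.Bool using (Bool; true; false; not; if_then_else_)
open import Data.Bool.Properties using (not-involutive)
open import Data.Empty using (⊥; ⊥-elim)
open import Data.Fin using (toℕ; fromℕ<)
open import Data.Fin.Properties using (toℕ<n; fromℕ<-toℕ; toℕ-fromℕ<)
open import Data.Fin.Subset using (Subset)
open import Data.List using (List; []; _∷_; map; _++_; length; applyUpTo)
open import Data.List.Properties using (length-map; length-++; ∷-injective)
open import Data.List.Membership.Propositional using (_∈_)
open import Data.List.Membership.Propositional.Properties using (∈-map⁺; ∈-map⁻; ∈-++⁺ˡ; ∈-++⁺ʳ; ∈-++⁻)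
open import Data.List.Relation.Unary.All using (All; []; _∷_)
import Data.List.Relation.Unary.All as All
import Data.List.Relation.Unary.All.Properties as All
open import Data.List.Relation.Unary.AllPairs using ([]; _∷_)
open import Data.List.Relation.Unary.Any using (here)
open import Data.List.Relation.Unary.Unique.Propositional using (Unique)
open import Data.List.Relation.Unary.Unique.Propositional.Properties using (++⁺; map⁺)
open import Data.Nat
open import Data.Nat.Combinatorics using (_C_; nCk+nC[k+1]≡[n+1]C[k+1]; nCk≡nC[n∸k]; nC1≡n)
open import Data.Nat.DivMod using (_/_; _%_; m*n/n≡m; m≡m%n+[m/n]*n; m%n<n)
open import Data.Nat.ListAction using (sum)
open import Data.Nat.Properties
open import Data.Nat.Tactic.RingSolver using (solve-∀)
open import Data.Product using (∃-syntax; _×_; _,_; proj₁; proj₂)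
open import Data.Sum as Sum using (_⊎_; inj₁; inj₂)
open import Data.Vec using (lookup; tabulate)
open import Data.Vec.Properties using ([]=⇒lookup; lookup⇒[]=; lookup∘tabulate; tabulate-cong; tabulate∘lookup)
open import Function using (_∘_)
open import Function.Bundles using (_⇔_; mk⇔)
open import Relation.Binary.Construct.Closure.ReflexiveTransitive using (ε; _◅_)
open import Relation.Binary.PropositionalEquality
open import Relation.Nullary using (¬_; Dec; yes; no; _×-dec_)

double : ℕ → ℕ
double zero    = zero
double (suc n) = suc (suc (double n))

double≡2* : ∀ n → double n ≡ 2 * n
double≡2* zero    = refl
double≡2* (suc n) = cong suc (trans (cong suc (double≡2* n)) (sym (+-suc n (n + 0))))

double≡+ : ∀ n → double n ≡ n + n
double≡+ n = trans (double≡2* n) (cong (n +_) (+-identityʳ n))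

double-∸ : ∀ m n → double m ∸ double n ≡ double (m ∸ n)
double-∸ m       zero    = refl
double-∸ zero    (suc n) = refl
double-∸ (suc m) (suc n) = double-∸ m n

⌈double/2⌉ : ∀ n → ⌈ double n /2⌉ ≡ n
⌈double/2⌉ zero    = refl
⌈double/2⌉ (suc n) = cong suc (⌈double/2⌉ n)

⌊double/2⌋ : ∀ n → ⌊ double n /2⌋ ≡ n
⌊double/2⌋ zero    = refl
⌊double/2⌋ (suc n) = cong suc (⌊double/2⌋ n)

double-or-odd : ∀ n → ∃[ m ] (n ≡ double m ⊎ n ≡ suc (double m))
double-or-odd zero = 0 , inj₁ refl
double-or-odd (suc n) with double-or-odd n
... | m , inj₁ n≡2m   = m , inj₂ (cong suc n≡2m)
... | m , inj₂ n≡2m+1 = suc m , inj₁ (cong suc n≡2m+1)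

sumBelow : ℕ → (ℕ → ℕ) → ℕ
sumBelow zero    f = 0
sumBelow (suc n) f = f 0 + sumBelow n (λ i → f (suc i))

sum-map-applyUpTo : ∀ n (f g : ℕ → ℕ) → sum (map f (applyUpTo g n)) ≡ sumBelow n (λ i → f (g i))
sum-map-applyUpTo zero    f g = refl
sum-map-applyUpTo (suc n) f g = cong (f (g 0) +_) (sum-map-applyUpTo n f (λ i → g (suc i)))

sumBelow-cong : ∀ n {f g : ℕ → ℕ} → (∀ i → f i ≡ g i) → sumBelow n f ≡ sumBelow n g
sumBelow-cong zero    f≗g = refl
sumBelow-cong (suc n) f≗g = cong₂ _+_ (f≗g 0) (sumBelow-cong n (λ i → f≗g (suc i)))

sumBelow-+ : ∀ n (f g : ℕ → ℕ) → sumBelow n (λ i → f i + g i) ≡ sumBelow n f + sumBelow n g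
sumBelow-+ zero    f g = refl
sumBelow-+ (suc n) f g
  rewrite sumBelow-+ n (λ i → f (suc i)) (λ i → g (suc i)) = interchange (f 0) (g 0) _ _
  where
  interchange : ∀ a b c d → a + b + (c + d) ≡ a + c + (b + d)
  interchange = solve-∀

sumBelow-evens : ∀ n (f : ℕ → ℕ) → (∀ i → f (suc (double i)) ≡ 0) →
                 sumBelow (suc (double n)) f ≡ sumBelow (suc n) (λ i → f (double i))
sumBelow-evens zero    f odd≡0 = refl
sumBelow-evens (suc n) f odd≡0 rewrite odd≡0 0 =
  cong (f 0 +_) (sumBelow-evens n (λ i → f (suc (suc i))) (λ i → odd≡0 (suc i)))

-- Binomial coefficients and lattice paths

pascal : ∀ n k → n C k + n C suc k ≡ suc n C suc k
pascal = nCk+nC[k+1]≡[n+1]C[k+1]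

C-sym : ∀ {n} a b → a + b ≡ n → n C a ≡ n C b
C-sym {n} a b a+b≡n = trans (nCk≡nC[n∸k] a≤n) (cong (n C_) n∸a≡b)
  where
  a≤n : a ≤ n
  a≤n = subst (a ≤_) a+b≡n (m≤m+n a b)
  n∸a≡b : n ∸ a ≡ b
  n∸a≡b = trans (cong (_∸ a) (sym a+b≡n)) (m+n∸m≡n a b)

C-central : ∀ m → suc (double m) C m ≡ suc (double m) C suc m
C-central m = C-sym m (suc m) (trans (+-suc m m) (cong suc (sym (double≡+ m))))

C-absorb : ∀ n k → suc k * (suc n C suc k) ≡ suc n * (n C k)
C-absorb zero    zero    = refl
C-absorb zero    (suc k) = *-zeroʳ (suc (suc k))
C-absorb (suc n) zero    =
  trans (+-identityʳ _) (trans (nC1≡n (suc (suc n))) (sym (*-identityʳ (suc (suc n)))))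
C-absorb (suc n) (suc k) = begin
  suc (suc k) * (suc (suc n) C suc (suc k))     ≡⟨ cong (suc (suc k) *_) (sym (pascal (suc n) (suc k))) ⟩
  suc (suc k) * (X + Y)                         ≡⟨ expand X Y (suc k) ⟩
  X + suc k * X + suc (suc k) * Y               ≡⟨ cong₂ (λ u v → X + u + v) (C-absorb n k) (C-absorb n (suc k)) ⟩
  X + suc n * (n C k) + suc n * (n C suc k)     ≡⟨ collect X (suc n) (n C k) (n C suc k) ⟩
  X + suc n * (n C k + n C suc k)               ≡⟨ cong (λ u → X + suc n * u) (pascal n k) ⟩
  suc (suc n) * X                               ∎
  where
  open ≡-Reasoning
  X Y : ℕ
  X = suc n C suc k
  Y = suc n C suc (suc k)
  expand : ∀ X Y a → suc a * (X + Y) ≡ X + a * X + suc a * Y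
  expand = solve-∀
  collect : ∀ X b c d → X + b * c + b * d ≡ X + b * (c + d)
  collect = solve-∀

-- Obtained by adding (k+1)·C(k+m,k) to both sides, which turns the left side
-- into (k+1)·C(k+m+1,k+1) by Pascal's rule.
C-ratio : ∀ k m → suc k * ((k + m) C suc k) ≡ m * ((k + m) C k)
C-ratio k m = +-cancelʳ-≡ (suc k * A) _ _ (begin
  suc k * B + suc k * A      ≡⟨ sym (*-distribˡ-+ (suc k) B A) ⟩
  suc k * (B + A)            ≡⟨ cong (suc k *_) (trans (+-comm B A) (pascal (k + m) k)) ⟩
  suc k * (suc n C suc k)    ≡⟨ C-absorb n k ⟩
  suc n * A                  ≡⟨ cong (_* A) (trans (cong suc (+-comm k m)) (sym (+-suc m k))) ⟩
  (m + suc k) * A            ≡⟨ *-distribʳ-+ A m (suc k) ⟩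
  m * A + suc k * A          ∎)
  where
  open ≡-Reasoning
  n A B : ℕ
  n = k + m
  A = n C k
  B = n C suc k

-- Paths of n steps ±1 from height h down to height 0 that never go below 0.
dyck : ℕ → ℕ → ℕ
dyck zero    zero    = 1
dyck zero    (suc h) = 0
dyck (suc n) zero    = dyck n 1
dyck (suc n) (suc h) = dyck n h + dyck n (suc (suc h))

-- Height sequences of walks of n steps from height h to height 0 in which a
-- down-step from height 0 stays at 0.
paths : ℕ → ℕ → List (List ℕ)
paths zero    zero    = [] ∷ []
paths zero    (suc h) = []
paths (suc n) h       = map (suc h ∷_) (paths n (suc h)) ++ map (pred h ∷_) (paths n (pred h))

#paths : ℕ → ℕ → ℕ
#paths n h = length (paths n h)

#paths-suc : ∀ n h → #paths (suc n) h ≡ #paths n (suc h) + #paths n (pred h)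
#paths-suc n h = trans (length-++ (map (suc h ∷_) (paths n (suc h))))
  (cong₂ _+_ (length-map (suc h ∷_) (paths n (suc h))) (length-map (pred h ∷_) (paths n (pred h))))

-- The reflection principle, in subtraction-free form.
dyck+#paths≡#paths : ∀ n h → dyck n h + #paths n (suc h) ≡ #paths n h
dyck+#paths≡#paths zero    zero    = refl
dyck+#paths≡#paths zero    (suc h) = refl
dyck+#paths≡#paths (suc n) zero    = begin
  dyck n 1 + #paths (suc n) 1            ≡⟨ cong (dyck n 1 +_) (#paths-suc n 1) ⟩
  dyck n 1 + (#paths n 2 + #paths n 0)   ≡⟨ +-assoc (dyck n 1) _ _ ⟨
  dyck n 1 + #paths n 2 + #paths n 0     ≡⟨ cong (_+ #paths n 0) (dyck+#paths≡#paths n 1) ⟩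
  #paths n 1 + #paths n 0                ≡⟨ #paths-suc n 0 ⟨
  #paths (suc n) 0                       ∎
  where open ≡-Reasoning
dyck+#paths≡#paths (suc n) (suc h) = begin
  dyck n h + dyck n (2 + h) + #paths (suc n) (2 + h)
    ≡⟨ cong (dyck n h + dyck n (2 + h) +_) (#paths-suc n (2 + h)) ⟩
  dyck n h + dyck n (2 + h) + (#paths n (3 + h) + #paths n (suc h))
    ≡⟨ regroup (dyck n h) (dyck n (2 + h)) _ _ ⟩
  (dyck n h + #paths n (suc h)) + (dyck n (2 + h) + #paths n (3 + h))
    ≡⟨ cong₂ _+_ (dyck+#paths≡#paths n h) (dyck+#paths≡#paths n (2 + h)) ⟩
  #paths n h + #paths n (2 + h)
    ≡⟨ +-comm (#paths n h) _ ⟩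
  #paths n (2 + h) + #paths n h
    ≡⟨ #paths-suc n (suc h) ⟨
  #paths (suc n) (suc h) ∎
  where
  open ≡-Reasoning
  regroup : ∀ a b c d → a + b + (c + d) ≡ (a + d) + (b + c)
  regroup = solve-∀

central-pascal : ∀ n → n C ⌈ suc n /2⌉ + n C ⌈ n /2⌉ ≡ suc n C ⌈ suc n /2⌉
central-pascal n with double-or-odd n
... | m , inj₁ refl = begin
  double m C suc ⌊ double m /2⌋ + double m C ⌈ double m /2⌉
    ≡⟨ cong₂ (λ a b → double m C suc a + double m C b) (⌊double/2⌋ m) (⌈double/2⌉ m) ⟩
  double m C suc m + double m C m
    ≡⟨ +-comm (double m C suc m) _ ⟩
  double m C m + double m C suc m
    ≡⟨ pascal (double m) m ⟩
  suc (double m) C suc m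
    ≡⟨ cong (λ a → suc (double m) C suc a) (⌊double/2⌋ m) ⟨
  suc (double m) C suc ⌊ double m /2⌋ ∎
  where open ≡-Reasoning
... | m , inj₂ refl = begin
  N C suc ⌈ double m /2⌉ + N C suc ⌊ double m /2⌋
    ≡⟨ cong₂ (λ a b → N C suc a + N C suc b) (⌈double/2⌉ m) (⌊double/2⌋ m) ⟩
  N C suc m + N C suc m
    ≡⟨ cong (_+ N C suc m) (C-central m) ⟨
  N C m + N C suc m
    ≡⟨ pascal N m ⟩
  suc N C suc m
    ≡⟨ cong (λ a → suc N C suc a) (⌈double/2⌉ m) ⟨
  suc N C suc ⌈ double m /2⌉ ∎
  where
  open ≡-Reasoning
  N : ℕ
  N = suc (double m)

#paths≡C : ∀ n h → #paths n h ≡ n C ⌈ n + h /2⌉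
#paths≡C zero    zero    = refl
#paths≡C zero    (suc h) = refl
#paths≡C (suc n) zero    = begin
  #paths (suc n) 0
    ≡⟨ #paths-suc n 0 ⟩
  #paths n 1 + #paths n 0
    ≡⟨ cong₂ _+_ (#paths≡C n 1) (#paths≡C n 0) ⟩
  n C ⌈ n + 1 /2⌉ + n C ⌈ n + 0 /2⌉
    ≡⟨ cong₂ (λ a b → n C ⌈ a /2⌉ + n C ⌈ b /2⌉) (+-comm n 1) (+-identityʳ n) ⟩
  n C ⌈ suc n /2⌉ + n C ⌈ n /2⌉
    ≡⟨ central-pascal n ⟩
  suc n C ⌈ suc n /2⌉
    ≡⟨ cong (λ a → suc n C ⌈ a /2⌉) (+-identityʳ (suc n)) ⟨
  suc n C ⌈ suc n + 0 /2⌉ ∎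
  where open ≡-Reasoning
#paths≡C (suc n) (suc h) = begin
  #paths (suc n) (suc h)
    ≡⟨ #paths-suc n (suc h) ⟩
  #paths n (2 + h) + #paths n h
    ≡⟨ cong₂ _+_ (#paths≡C n (2 + h)) (#paths≡C n h) ⟩
  n C ⌈ n + (2 + h) /2⌉ + n C c
    ≡⟨ cong (λ a → n C ⌈ a /2⌉ + n C c) (trans (+-suc n (suc h)) (cong suc (+-suc n h))) ⟩
  n C suc c + n C c
    ≡⟨ +-comm (n C suc c) _ ⟩
  n C c + n C suc c
    ≡⟨ pascal n c ⟩
  suc n C suc c
    ≡⟨ cong (λ a → suc n C ⌈ suc a /2⌉) (+-suc n h) ⟨
  suc n C ⌈ suc n + suc h /2⌉ ∎
  where
  open ≡-Reasoning
  c : ℕ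
  c = ⌈ n + h /2⌉

#paths-central : ∀ m → #paths (double m) 0 ≡ double m C m
#paths-central m = trans (#paths≡C (double m) 0)
  (cong (double m C_) (trans (cong ⌈_/2⌉ (+-identityʳ (double m))) (⌈double/2⌉ m)))

dyck-odd : ∀ m → dyck (suc (double m)) 0 ≡ 0
dyck-odd m = +-cancelʳ-≡ (#paths n 1) _ 0 (begin
  dyck n 0 + #paths n 1 ≡⟨ dyck+#paths≡#paths n 0 ⟩
  #paths n 0            ≡⟨ #paths≡C n 0 ⟩
  n C ⌈ n + 0 /2⌉       ≡⟨ cong (λ a → n C ⌈ a /2⌉) (+-identityʳ n) ⟩
  n C suc ⌊ double m /2⌋ ≡⟨ cong (λ a → n C suc a) (⌊double/2⌋ m) ⟩
  n C suc m             ≡⟨ cong (n C_) (⌈double/2⌉ (suc m)) ⟨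
  n C ⌈ double (suc m) /2⌉ ≡⟨ cong (λ a → n C ⌈ a /2⌉) (+-comm n 1) ⟨
  n C ⌈ n + 1 /2⌉       ≡⟨ #paths≡C n 1 ⟨
  #paths n 1            ∎)
  where
  open ≡-Reasoning
  n : ℕ
  n = suc (double m)

dyck*suc≡C : ∀ i → dyck (double i) 0 * suc i ≡ double i C i
dyck*suc≡C i = +-cancelʳ-≡ (i * X) _ _ (begin
  d * suc i + i * X          ≡⟨ cong (d * suc i +_) (sym suc*Y≡i*X) ⟩
  d * suc i + suc i * Y      ≡⟨ factor d Y (suc i) ⟩
  (d + Y) * suc i            ≡⟨ cong (_* suc i) d+Y≡X ⟩
  X * suc i                  ≡⟨ *-suc X i ⟩
  X + X * i                  ≡⟨ cong (X +_) (*-comm X i) ⟩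
  X + i * X                  ∎)
  where
  open ≡-Reasoning
  d X Y : ℕ
  d = dyck (double i) 0
  X = double i C i
  Y = double i C suc i
  d+Y≡X : d + Y ≡ X
  d+Y≡X = begin
    d + Y                               ≡⟨ cong (λ a → d + double i C suc a) (⌊double/2⌋ i) ⟨
    d + double i C suc ⌊ double i /2⌋   ≡⟨ cong (λ a → d + double i C ⌈ a /2⌉) (+-comm (double i) 1) ⟨
    d + double i C ⌈ double i + 1 /2⌉   ≡⟨ cong (d +_) (#paths≡C (double i) 1) ⟨
    d + #paths (double i) 1             ≡⟨ dyck+#paths≡#paths (double i) 0 ⟩
    #paths (double i) 0                 ≡⟨ #paths-central i ⟩
    X                                   ∎
  suc*Y≡i*X : suc i * Y ≡ i * X
  suc*Y≡i*X = subst (λ n → suc i * (n C suc i) ≡ i * (n C i)) (sym (double≡+ i)) (C-ratio i i)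
  factor : ∀ d Y a → d * a + a * Y ≡ (d + Y) * a
  factor = solve-∀

catalan≡dyck : ∀ i → catalan i ≡ dyck (double i) 0
catalan≡dyck i = begin
  ((2 * i) C i) / suc i            ≡⟨ cong (λ n → (n C i) / suc i) (double≡2* i) ⟨
  (double i C i) / suc i           ≡⟨ cong (_/ suc i) (dyck*suc≡C i) ⟨
  (dyck (double i) 0 * suc i) / suc i ≡⟨ m*n/n≡m (dyck (double i) 0) (suc i) ⟩
  dyck (double i) 0                ∎
  where open ≡-Reasoning

-- Split a path at its first down-step from height 0 (after m steps); before it
-- the path is a Dyck path from h to 0.
#paths-firstFloorStep : ∀ n h → #paths n h ≡ dyck n h + sumBelow n (λ m → dyck m h * #paths (n ∸ suc m) 0)
#paths-firstFloorStep zero    zero    = refl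
#paths-firstFloorStep zero    (suc h) = refl
#paths-firstFloorStep (suc n) zero    = begin
  #paths (suc n) 0                  ≡⟨ #paths-suc n 0 ⟩
  #paths n 1 + #paths n 0           ≡⟨ cong (_+ #paths n 0) (#paths-firstFloorStep n 1) ⟩
  dyck n 1 + S + #paths n 0         ≡⟨ shuffle (dyck n 1) S (#paths n 0) ⟩
  dyck n 1 + (1 * #paths n 0 + S)   ∎
  where
  open ≡-Reasoning
  S : ℕ
  S = sumBelow n (λ m → dyck m 1 * #paths (n ∸ suc m) 0)
  shuffle : ∀ a b c → a + b + c ≡ a + (1 * c + b)
  shuffle = solve-∀
#paths-firstFloorStep (suc n) (suc h) = begin
  #paths (suc n) (suc h)
    ≡⟨ #paths-suc n (suc h) ⟩
  #paths n (2 + h) + #paths n h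
    ≡⟨ cong₂ _+_ (#paths-firstFloorStep n (2 + h)) (#paths-firstFloorStep n h) ⟩
  (dyck n (2 + h) + sumBelow n f₂) + (dyck n h + sumBelow n f₁)
    ≡⟨ shuffle (dyck n (2 + h)) (sumBelow n f₂) (dyck n h) (sumBelow n f₁) ⟩
  dyck n h + dyck n (2 + h) + (sumBelow n f₁ + sumBelow n f₂)
    ≡⟨ cong (dyck n h + dyck n (2 + h) +_) (sumBelow-+ n f₁ f₂) ⟨
  dyck n h + dyck n (2 + h) + sumBelow n (λ m → f₁ m + f₂ m)
    ≡⟨ cong (dyck n h + dyck n (2 + h) +_) (sumBelow-cong n λ m →
         *-distribʳ-+ (#paths (n ∸ suc m) 0) (dyck m h) (dyck m (2 + h)) ) ⟨
  dyck n h + dyck n (2 + h) + sumBelow n (λ m → dyck (suc m) (suc h) * #paths (n ∸ suc m) 0) ∎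
  where
  open ≡-Reasoning
  f₁ f₂ : ℕ → ℕ
  f₁ m = dyck m h * #paths (n ∸ suc m) 0
  f₂ m = dyck m (2 + h) * #paths (n ∸ suc m) 0
  shuffle : ∀ a b c d → (a + b) + (c + d) ≡ c + a + (d + b)
  shuffle = solve-∀

#paths≡formula : ∀ k → #paths (suc (double k)) 0 ≡ formula k
#paths≡formula k = begin
  #paths (suc (double k)) 0
    ≡⟨ #paths-firstFloorStep (suc (double k)) 0 ⟩
  dyck (suc (double k)) 0 + sumBelow (suc (double k)) f
    ≡⟨ cong (_+ sumBelow (suc (double k)) f) (dyck-odd k) ⟩
  sumBelow (suc (double k)) f
    ≡⟨ sumBelow-evens k f (λ i → cong (_* #paths (double k ∸ suc (double i)) 0) (dyck-odd i)) ⟩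
  sumBelow (suc k) (λ i → f (double i))
    ≡⟨ sumBelow-cong (suc k) term ⟩
  sumBelow (suc k) g
    ≡⟨ sum-map-applyUpTo (suc k) g (λ i → i) ⟨
  formula k ∎
  where
  open ≡-Reasoning
  f g : ℕ → ℕ
  f m = dyck m 0 * #paths (double k ∸ m) 0
  g i = catalan i * ((2 * (k ∸ i)) C (k ∸ i))
  term : ∀ i → f (double i) ≡ g i
  term i = cong₂ _*_ (sym (catalan≡dyck i)) (begin
    #paths (double k ∸ double i) 0   ≡⟨ cong (λ n → #paths n 0) (double-∸ k i) ⟩
    #paths (double (k ∸ i)) 0        ≡⟨ #paths-central (k ∸ i) ⟩
    double (k ∸ i) C (k ∸ i)         ≡⟨ cong (_C (k ∸ i)) (double≡2* (k ∸ i)) ⟩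
    (2 * (k ∸ i)) C (k ∸ i)          ∎)

module _ {s t : ℕ} where

  InSemigroup-+ : ∀ {y x} a b → InSemigroup s t y → x ≡ y + a * s + b * t → InSemigroup s t x
  InSemigroup-+ a b (k₁ , k₂ , refl) x≡ = k₁ + a , k₂ + b , trans x≡ (regroup k₁ k₂ a b s t)
    where
    regroup : ∀ k₁ k₂ a b s t → k₁ * s + k₂ * t + a * s + b * t ≡ (k₁ + a) * s + (k₂ + b) * t
    regroup = solve-∀

  InP-below : ∀ {y x} a b → y ≢ 0 → InP s t x → x ≡ y + a * s + b * t → InP s t y
  InP-below a b y≢0 (_ , x∉S) x≡ = y≢0 , λ y∈S → x∉S (InSemigroup-+ a b y∈S x≡)

  Leq⇒offset : ∀ {y x} → Leq s t y x → ∃[ a ] ∃[ b ] (x ≡ y + a * s + b * t)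
  Leq⇒offset {y} ε = 0 , 0 , sym (trans (+-identityʳ _) (+-identityʳ y))
  Leq⇒offset {y} ((_ , _ , inj₁ refl) ◅ z⪯x) with Leq⇒offset z⪯x
  ... | a , b , x≡ = suc a , b , trans x≡ (regroup y s a b t)
    where
    regroup : ∀ y s a b t → y + s + a * s + b * t ≡ y + suc a * s + b * t
    regroup = solve-∀
  Leq⇒offset {y} ((_ , _ , inj₂ refl) ◅ z⪯x) with Leq⇒offset z⪯x
  ... | a , b , x≡ = a , suc b , trans x≡ (regroup y s a b t)
    where
    regroup : ∀ y s a b t → y + t + a * s + b * t ≡ y + a * s + suc b * t
    regroup = solve-∀

  offset⇒Leq : ∀ {y x} a b → y ≢ 0 → InP s t x → x ≡ y + a * s + b * t → Leq s t y x
  offset⇒Leq {y} zero zero y≢0 x∈P x≡ =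
    subst (Leq s t y) (sym (trans x≡ (trans (+-identityʳ _) (+-identityʳ y)))) ε
  offset⇒Leq {y} {x} (suc a) b y≢0 x∈P x≡ =
    (InP-below (suc a) b y≢0 x∈P x≡ , InP-below a b y+s≢0 x∈P x≡′ , inj₁ refl)
      ◅ offset⇒Leq a b y+s≢0 x∈P x≡′
    where
    y+s≢0 : y + s ≢ 0
    y+s≢0 = y≢0 ∘ m+n≡0⇒m≡0 y
    x≡′ : x ≡ y + s + a * s + b * t
    x≡′ = trans x≡ (regroup y s a b t)
      where
      regroup : ∀ y s a b t → y + suc a * s + b * t ≡ y + s + a * s + b * t
      regroup = solve-∀
  offset⇒Leq {y} {x} zero (suc b) y≢0 x∈P x≡ =
    (InP-below 0 (suc b) y≢0 x∈P x≡ , InP-below 0 b y+t≢0 x∈P x≡′ , inj₂ refl)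
      ◅ offset⇒Leq 0 b y+t≢0 x∈P x≡′
    where
    y+t≢0 : y + t ≢ 0
    y+t≢0 = y≢0 ∘ m+n≡0⇒m≡0 y
    x≡′ : x ≡ y + t + 0 * s + b * t
    x≡′ = trans x≡ (regroup y s b t)
      where
      regroup : ∀ y s b t → y + 0 * s + suc b * t ≡ y + t + 0 * s + b * t
      regroup = solve-∀

-- Coordinates on M_{2k+1,2k+3}

divMod-unique : ∀ w {q q′ j j′} → j < w → j′ < w → q * w + j ≡ q′ * w + j′ → q ≡ q′ × j ≡ j′
divMod-unique w {zero}  {zero}   j<w j′<w eq = refl , eq
divMod-unique w {zero}  {suc q′} {j′ = j′} j<w j′<w eq =
  ⊥-elim (<⇒≱ j<w (≤-trans (m≤m+n w (q′ * w + j′))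
    (≤-reflexive (trans (sym (+-assoc w (q′ * w) j′)) (sym eq)))))
divMod-unique w {suc q} {zero}   {j = j} j<w j′<w eq =
  ⊥-elim (<⇒≱ j′<w (≤-trans (m≤m+n w (q * w + j))
    (≤-reflexive (trans (sym (+-assoc w (q * w) j)) eq))))
divMod-unique w {suc q} {suc q′} {j} {j′} j<w j′<w eq with
  divMod-unique w {q} {q′} j<w j′<w
    (+-cancelˡ-≡ w _ _ (trans (sym (+-assoc w (q * w) j)) (trans eq (+-assoc w (q′ * w) j′))))
... | refl , refl = refl , refl

module Grid (k : ℕ) where

  W : ℕ
  W = suc (suc (2 * k))

  s t : ℕ
  s = sM k
  t = tM k

  cell : ℕ → ℕ → ℕ
  cell r j = r * W + j

  InTriangle : ℕ → ℕ → Set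
  InTriangle r j = r < j × j + r ≤ 2 * k

  cell-divMod : ∀ x → x ≡ cell (x / W) (x % W)
  cell-divMod x = trans (m≡m%n+[m/n]*n x W) (+-comm (x % W) ((x / W) * W))

  cell-injective : ∀ {r r′ j j′} → j < W → j′ < W → cell r j ≡ cell r′ j′ → r ≡ r′ × j ≡ j′
  cell-injective = divMod-unique W

  cell-coords : ∀ r j → j < W → cell r j / W ≡ r × cell r j % W ≡ j
  cell-coords r j j<W = cell-injective (m%n<n (cell r j) W) j<W (sym (cell-divMod (cell r j)))

  cell-+1 : ∀ r j → cell r (suc j) ≡ cell r j + 1
  cell-+1 r j = trans (cong (r * W +_) (+-comm 1 j)) (sym (+-assoc (r * W) j 1))

  cell-+s : ∀ r j → cell (suc r) j ≡ cell r (suc j) + s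
  cell-+s r j = identity k r j
    where
    identity : ∀ k r j → suc r * suc (suc (2 * k)) + j ≡ r * suc (suc (2 * k)) + suc j + (2 * k + 1)
    identity = solve-∀

  cell-+t : ∀ r j → cell (suc r) (suc j) ≡ cell r j + t
  cell-+t r j = identity k r j
    where
    identity : ∀ k r j → suc r * suc (suc (2 * k)) + suc j ≡ r * suc (suc (2 * k)) + j + (2 * k + 3)
    identity = solve-∀

  triangle-bounded : ∀ {r j} → InTriangle r j → cell r j < Bound k
  triangle-bounded {r} {j} (r<j , j+r≤2k) =
    subst (cell r j <_) (sym (bound-expand k)) (s≤s (≤-trans cell≤ (m≤m+n _ _)))
    where
    r≤k : r ≤ k
    r≤k = *-cancelˡ-≤ 2 (subst (_≤ 2 * k) (sym (cong (r +_) (+-identityʳ r)))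
            (≤-trans (+-monoˡ-≤ r (<⇒≤ r<j)) j+r≤2k))
    cell≤ : cell r j ≤ k * W + 2 * k
    cell≤ = +-mono-≤ (*-monoˡ-≤ W r≤k) (m+n≤o⇒m≤o j j+r≤2k)
    bound-expand : ∀ k → (2 * k + 1) * (2 * k + 3) ≡ suc (k * suc (suc (2 * k)) + 2 * k + (2 * k * k + 4 * k + 2))
    bound-expand = solve-∀

  2k+2≢0 : 2 * k + 2 ≢ 0
  2k+2≢0 eq with m+n≡0⇒n≡0 (2 * k) eq
  ... | ()

  Excluded : ℕ → Set
  Excluded x = InSemigroup s t x ⊎ ∃[ a ] ∃[ b ] (x ≡ 2 * k + 2 + a * s + b * t)

  excluded⇒∉M : ∀ {x} → Excluded x → ¬ InM k x
  excluded⇒∉M (inj₁ x∈S)           ((_ , x∉S) , _)  = x∉S x∈S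
  excluded⇒∉M (inj₂ (a , b , x≡)) (x∈P , 2k+2⋠x) = 2k+2⋠x (offset⇒Leq a b 2k+2≢0 x∈P x≡)

  -- a·s + b·t + a = (a + b)·W + b, so the elements of ⟨s,t⟩ and of 2k + 2 + ⟨s,t⟩
  -- are of this shape with R = a + b and R = a + b + 1 respectively.
  triangle∌-shifted : ∀ {r j} a b R → InTriangle r j → a + b ≤ R → cell r j + a ≢ R * W + b
  triangle∌-shifted {r} {j} a b R (r<j , j+r≤2k) a+b≤R eq with R ≤? r
  ... | yes R≤r = <⇒≱ r<j (≤-trans j≤b (≤-trans (m+n≤o⇒n≤o a a+b≤R) R≤r))
    where
    j≤b : j ≤ b
    j≤b = m+n≤o⇒m≤o j (+-cancelˡ-≤ (R * W) _ _
            (≤-trans (+-monoˡ-≤ (j + a) (*-monoˡ-≤ W R≤r)) (≤-reflexive (trans (sym (+-assoc (r * W) j a)) eq))))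
  ... | no R≰r with m≤n⇒∃[o]m+o≡n (≰⇒> R≰r)
  ...   | d , refl = <⇒≱ (+-monoˡ-< d ≤-refl) (begin
      W + d           ≤⟨ +-monoʳ-≤ W (m≤m*n d W) ⟩
      W + d * W       ≤⟨ m≤m+n _ b ⟩
      W + d * W + b   ≡⟨ +-cancelˡ-≡ (r * W) _ _ (trans (sym (+-assoc (r * W) j a)) (sym eq′)) ⟨
      j + a           ≤⟨ +-monoʳ-≤ j (m+n≤o⇒m≤o a a+b≤R) ⟩
      j + (suc r + d) ≡⟨ +-assoc j (suc r) d ⟨
      j + suc r + d   ≤⟨ +-monoˡ-≤ d (≤-reflexive (+-suc j r)) ⟩
      suc (j + r) + d ≤⟨ +-monoˡ-≤ d (s≤s j+r≤2k) ⟩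
      suc (2 * k) + d ∎)
    where
    open ≤-Reasoning
    eq′ : r * W + (W + d * W + b) ≡ cell r j + a
    eq′ = trans (regroup r d W b) (sym eq)
      where
      regroup : ∀ r d W b → r * W + (W + d * W + b) ≡ (suc r + d) * W + b
      regroup = solve-∀

  triangle⇒¬excluded : ∀ {r j} → InTriangle r j → ¬ Excluded (cell r j)
  triangle⇒¬excluded T (inj₁ (a , b , eq)) =
    triangle∌-shifted a b (a + b) T ≤-refl (trans (cong (_+ a) eq) (identity k a b))
    where
    identity : ∀ k a b → a * (2 * k + 1) + b * (2 * k + 3) + a ≡ (a + b) * suc (suc (2 * k)) + b
    identity = solve-∀
  triangle⇒¬excluded T (inj₂ (a , b , eq)) =
    triangle∌-shifted a b (suc (a + b)) T (n≤1+n _) (trans (cong (_+ a) eq) (identity k a b))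
    where
    identity : ∀ k a b → 2 * k + 2 + a * (2 * k + 1) + b * (2 * k + 3) + a ≡ suc (a + b) * suc (suc (2 * k)) + b
    identity = solve-∀

  below-diagonal-excluded : ∀ {q j} → j ≤ q → Excluded (cell q j)
  below-diagonal-excluded {q} {j} j≤q with m≤n⇒∃[o]m+o≡n j≤q
  ... | e , refl with double-or-odd e
  ...   | f , inj₁ refl = inj₁ (f , j + f ,
    trans (cong (λ m → (j + m) * W + j) (double≡+ f)) (identity k j f))
    where
    identity : ∀ k j f → (j + (f + f)) * suc (suc (2 * k)) + j ≡ f * (2 * k + 1) + (j + f) * (2 * k + 3)
    identity = solve-∀
  ...   | f , inj₂ refl = inj₂ (f , j + f ,
    trans (cong (λ m → (j + suc m) * W + j) (double≡+ f)) (identity k j f))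
    where
    identity : ∀ k j f → (j + suc (f + f)) * suc (suc (2 * k)) + j ≡ 2 * k + 2 + f * (2 * k + 1) + (j + f) * (2 * k + 3)
    identity = solve-∀

  cell-via-complement : ∀ {q j c y} → j + c ≡ suc (2 * k) → q * W + suc (2 * k) ≡ y + c → cell q j ≡ y
  cell-via-complement {q} {j} {c} j+c≡ eq =
    +-cancelʳ-≡ c _ _ (trans (+-assoc (q * W) j c) (trans (cong (q * W +_) j+c≡) eq))

  beyond-excluded : ∀ {q j} → j < W → 2 * k < j + q → Excluded (cell q j)
  beyond-excluded {q} {j} j<W 2k<j+q with m≤n⇒∃[o]m+o≡n (≤-pred j<W)
  ... | c , j+c≡ with m≤n⇒∃[o]m+o≡n (+-cancelˡ-≤ j c q (subst (_≤ j + q) (sym j+c≡) 2k<j+q))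
  ...   | g , refl with double-or-odd g
  ...     | f , inj₁ refl = inj₁ (suc (c + f) , f , cell-via-complement {c + double f} j+c≡
    (trans (cong (λ m → (c + m) * W + suc (2 * k)) (double≡+ f)) (identity k c f)))
    where
    identity : ∀ k c f → (c + (f + f)) * suc (suc (2 * k)) + suc (2 * k) ≡ suc (c + f) * (2 * k + 1) + f * (2 * k + 3) + c
    identity = solve-∀
  ...     | f , inj₂ refl = inj₂ (suc (c + f) , f , cell-via-complement {c + suc (double f)} j+c≡
    (trans (cong (λ m → (c + suc m) * W + suc (2 * k)) (double≡+ f)) (identity k c f)))
    where
    identity : ∀ k c f → (c + suc (f + f)) * suc (suc (2 * k)) + suc (2 * k)
                       ≡ 2 * k + 2 + suc (c + f) * (2 * k + 1) + f * (2 * k + 3) + c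
    identity = solve-∀

  ¬triangle⇒excluded : ∀ {q j} → j < W → ¬ InTriangle q j → Excluded (cell q j)
  ¬triangle⇒excluded {q} {j} j<W ¬T with suc q ≤? j | j + q ≤? 2 * k
  ... | yes q<j | yes j+q≤2k = ⊥-elim (¬T (q<j , j+q≤2k))
  ... | no q≮j  | _          = below-diagonal-excluded (≤-pred (≰⇒> q≮j))
  ... | yes _   | no j+q≰2k  = beyond-excluded j<W (≰⇒> j+q≰2k)

  triangle⇒InM : ∀ {r j} → InTriangle r j → InM k (cell r j)
  triangle⇒InM {r} {j} T = (cell≢0 , triangle⇒¬excluded T ∘ inj₁) , triangle⇒¬excluded T ∘ inj₂ ∘ Leq⇒offset
    where
    cell≢0 : cell r j ≢ 0
    cell≢0 eq = <⇒≢ (≤-<-trans z≤n (proj₁ T)) (sym (m+n≡0⇒n≡0 (r * W) eq))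

  InM⇒triangle : ∀ {x} → InM k x → InTriangle (x / W) (x % W)
  InM⇒triangle {x} x∈M with suc (x / W) ≤? x % W ×-dec x % W + x / W ≤? 2 * k
  ... | yes T = T
  ... | no ¬T = ⊥-elim (excluded⇒∉M (¬triangle⇒excluded (m%n<n x W) ¬T) (subst (InM k) (cell-divMod x) x∈M))

-- column h r holds iff r ∈ {h - 1, h - 3, h - 5, …}.
column : ℕ → ℕ → Bool
column zero    r       = false
column (suc h) zero    = not (column h zero)
column (suc h) (suc r) = column h r

column⇒< : ∀ h r → column h r ≡ true → r < h
column⇒< (suc h) zero    _ = s≤s z≤n
column⇒< (suc h) (suc r) c = s≤s (column⇒< h r c)

column-top : ∀ h → column (suc h) h ≡ true
column-top zero    = refl
column-top (suc h) = column-top h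

column-≥ : ∀ h r → h ≤ r → column h r ≡ false
column-≥ h r h≤r with column h r in c
... | true  = ⊥-elim (<⇒≱ (column⇒< h r c) h≤r)
... | false = refl

column⇒gap : ∀ h r → column (suc h) r ≡ true → ∃[ e ] h ≡ r + double e
column⇒gap zero          zero    _ = 0 , refl
column⇒gap (suc (suc h)) zero    c
  with column⇒gap h zero (trans (sym (not-involutive (column (suc h) zero))) c)
... | e , h≡ = suc e , cong (λ m → suc (suc m)) h≡
column⇒gap (suc h)       (suc r) c with column⇒gap h r c
... | e , h≡ = e , cong suc h≡

gap⇒column : ∀ r e → column (suc (r + double e)) r ≡ true
gap⇒column zero    zero    = refl
gap⇒column zero    (suc e) rewrite not-involutive (column (suc (double e)) zero) = gap⇒column zero e
gap⇒column (suc r) e       = gap⇒column r e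

column-nonadjacent : ∀ h r → column h r ≡ true → column (suc h) r ≡ true → ⊥
column-nonadjacent h zero c c′ with column h zero
column-nonadjacent h zero refl () | true
column-nonadjacent h zero ()   _  | false
column-nonadjacent (suc h) (suc r) c c′ = column-nonadjacent h r c c′

column-+2 : ∀ h r → column h r ≡ true → column (suc (suc h)) r ≡ true
column-+2 h       zero    c rewrite not-involutive (column h zero) = c
column-+2 (suc h) (suc r) c = column-+2 h r c

column-down-pred : ∀ h r → column h (suc r) ≡ true → column (pred h) r ≡ true
column-down-pred (suc h) r c = c

column-down-suc : ∀ h r → column h (suc r) ≡ true → column (suc h) r ≡ true
column-down-suc (suc h) r c = column-+2 h r c

column-up : ∀ h r → column (suc h) r ≡ true → r ≢ h → column h (suc r) ≡ true
column-up h r c r≢h with column⇒gap h r c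
... | zero  , h≡ = ⊥-elim (r≢h (sym (trans h≡ (+-identityʳ r))))
... | suc e , refl rewrite +-suc r (suc (double e)) | +-suc r (double e) = gap⇒column (suc r) e

Step : ℕ → ℕ → Set
Step a b = b ≡ suc a ⊎ b ≡ pred a

column-step-down : ∀ {a b} r → Step a b → column a (suc r) ≡ true → column b r ≡ true
column-step-down {a} r (inj₁ refl) = column-down-suc a r
column-step-down {a} r (inj₂ refl) = column-down-pred a r

column-step-up : ∀ {a b} r → Step a b → column b (suc r) ≡ true → column a r ≡ true
column-step-up         r (inj₁ refl) c = c
column-step-up {suc a} r (inj₂ refl) c = column-down-suc a r c

column-step-disjoint : ∀ {a b} r → Step a b → column a r ≡ true → column b r ≡ true → ⊥
column-step-disjoint {a}     r (inj₁ refl) c c′ = column-nonadjacent a r c c′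
column-step-disjoint {suc a} r (inj₂ refl) c c′ = column-nonadjacent a r c′ c

-- The height after j steps of the path with start h and later heights p
-- (0 once p is exhausted, which is where paths end).
heightAt : ℕ → List ℕ → ℕ → ℕ
heightAt h p       zero    = h
heightAt h []      (suc j) = 0
heightAt h (a ∷ p) (suc j) = heightAt a p j

paths-zero : ∀ {h p} → p ∈ paths zero h → p ≡ [] × h ≡ 0
paths-zero {zero} (here refl) = refl , refl

paths-suc : ∀ {n h p} → p ∈ paths (suc n) h → ∃[ a ] ∃[ p′ ] (p ≡ a ∷ p′ × Step h a × p′ ∈ paths n a)
paths-suc {n} {h} p∈ with ∈-++⁻ (map (suc h ∷_) (paths n (suc h))) p∈
... | inj₁ p∈₁ with ∈-map⁻ (suc h ∷_) p∈₁
...   | p′ , p′∈ , refl = suc h , p′ , refl , inj₁ refl , p′∈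
paths-suc {n} {h} p∈ | inj₂ p∈₂ with ∈-map⁻ (pred h ∷_) p∈₂
...   | p′ , p′∈ , refl = pred h , p′ , refl , inj₂ refl , p′∈

paths-length : ∀ {n h p} → p ∈ paths n h → length p ≡ n
paths-length {zero} {h} p∈ with paths-zero {h} p∈
... | refl , _ = refl
paths-length {suc n} {h} p∈ with paths-suc {n} {h} p∈
... | _ , _ , refl , _ , p′∈ = cong suc (paths-length p′∈)

paths-start≤ : ∀ {n h p} → p ∈ paths n h → h ≤ n
paths-start≤ {zero} {h} p∈ with paths-zero {h} p∈
... | _ , refl = z≤n
paths-start≤ {suc n} {h} p∈ with paths-suc {n} {h} p∈
... | _ , _ , refl , inj₁ refl , p′∈ = m≤n⇒m≤1+n (<⇒≤ (paths-start≤ p′∈))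
... | _ , _ , refl , inj₂ refl , p′∈ = ≤-trans (m≤suc[pred[m]] _) (s≤s (paths-start≤ p′∈))
  where
  m≤suc[pred[m]] : ∀ m → m ≤ suc (pred m)
  m≤suc[pred[m]] zero    = z≤n
  m≤suc[pred[m]] (suc m) = ≤-refl

paths-step : ∀ {n h p} → p ∈ paths n h → ∀ j → j < n → Step (heightAt h p j) (heightAt h p (suc j))
paths-step {suc n} {h} p∈ j j<n with paths-suc {n} {h} p∈
... | _ , _ , refl , h↝a , p′∈ with j
...   | zero   = h↝a
...   | suc j′ = paths-step p′∈ j′ (≤-pred j<n)

paths-column-bound : ∀ {n h p} → p ∈ paths n h → ∀ j r → column (heightAt h p j) r ≡ true → r < h + j × j + r < n
paths-column-bound {zero} {h} p∈ j r c with paths-zero {h} p∈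
paths-column-bound {zero} p∈ zero    r () | refl , refl
paths-column-bound {zero} p∈ (suc j) r () | refl , refl
paths-column-bound {suc n} {h} p∈ zero r c =
  subst (r <_) (sym (+-identityʳ h)) r<h , ≤-trans r<h (paths-start≤ {suc n} {h} p∈)
  where
  r<h : r < h
  r<h = column⇒< h r c
paths-column-bound {suc n} {h} p∈ (suc j) r c with paths-suc {n} {h} p∈
... | a , _ , refl , h↝a , p′∈ with paths-column-bound p′∈ j r c
...   | r<a+j , j+r<n =
  ≤-trans r<a+j (≤-trans (+-monoˡ-≤ j (a≤1+h h↝a)) (≤-reflexive (sym (+-suc h j)))) , s≤s j+r<n
  where
  a≤1+h : Step h a → a ≤ suc h
  a≤1+h (inj₁ refl) = ≤-refl
  a≤1+h (inj₂ refl) = ≤-trans pred[n]≤n (n≤1+n h)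

paths-unique : ∀ n h → Unique (paths n h)
paths-unique zero    zero    = [] ∷ []
paths-unique zero    (suc h) = []
paths-unique (suc n) h = ++⁺ (map⁺ (proj₂ ∘ ∷-injective) (paths-unique n (suc h)))
                             (map⁺ (proj₂ ∘ ∷-injective) (paths-unique n (pred h))) disjoint
  where
  disjoint : ∀ {p} → ¬ (p ∈ map (suc h ∷_) (paths n (suc h)) × p ∈ map (pred h ∷_) (paths n (pred h)))
  disjoint (p∈₁ , p∈₂) with ∈-map⁻ (suc h ∷_) p∈₁ | ∈-map⁻ (pred h ∷_) p∈₂
  ... | _ , _ , refl | _ , _ , eq = suc≢pred h (proj₁ (∷-injective eq))
    where
    suc≢pred : ∀ h → suc h ≢ pred h
    suc≢pred zero    ()
    suc≢pred (suc h) eq = <⇒≢ (m<n⇒m<1+n (n<1+n h)) (sym eq)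

Unique-map-retraction : ∀ {A B : Set} (f : A → B) (g : B → A) {xs : List A} →
                        All (λ x → g (f x) ≡ x) xs → Unique xs → Unique (map f xs)
Unique-map-retraction f g [] [] = []
Unique-map-retraction f g {x ∷ _} (gfx≡x ∷ gf≡) (x∉xs ∷ u) =
  All.map⁺ (All.zipWith distinct (x∉xs , gf≡)) ∷ Unique-map-retraction f g gf≡ u
  where
  distinct : ∀ {y} → x ≢ y × g (f y) ≡ y → f x ≢ f y
  distinct (x≢y , gfy≡y) fx≡fy = x≢y (trans (sym gfx≡x) (trans (cong g fx≡fy) gfy≡y))

≡true⇔≡true⇒≡ : ∀ {a b : Bool} → (a ≡ true → b ≡ true) → (b ≡ true → a ≡ true) → a ≡ b
≡true⇔≡true⇒≡ {true}  {true}  f g = refl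
≡true⇔≡true⇒≡ {true}  {false} f g = sym (f refl)
≡true⇔≡true⇒≡ {false} {true}  f g = g refl
≡true⇔≡true⇒≡ {false} {false} f g = refl

member : ∀ {N} → Subset N → ℕ → Bool
member {N} I x with x <? N
... | yes x<N = lookup I (fromℕ< x<N)
... | no  _   = false

member-toℕ : ∀ {N} (I : Subset N) i → member I (toℕ i) ≡ lookup I i
member-toℕ {N} I i with toℕ i <? N
... | yes i<N = cong (lookup I) (fromℕ<-toℕ i i<N)
... | no  i≮N = ⊥-elim (i≮N (toℕ<n i))

MemI⇒member : ∀ {N} (I : Subset N) x → MemI I x → member I x ≡ true
MemI⇒member I _ (i , refl , i∈I) = trans (member-toℕ I i) ([]=⇒lookup i∈I)

member⇒MemI : ∀ {N} (I : Subset N) x → member I x ≡ true → MemI I x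
member⇒MemI {N} I x x∈I with x <? N
... | yes x<N = fromℕ< x<N , toℕ-fromℕ< x<N , lookup⇒[]= (fromℕ< x<N) I x∈I

member-tabulate : ∀ {N} (f : ℕ → Bool) x → x < N → member {N} (tabulate (f ∘ toℕ)) x ≡ f x
member-tabulate {N} f x x<N with x <? N
... | yes x<N′ = trans (lookup∘tabulate (f ∘ toℕ) (fromℕ< x<N′)) (cong f (toℕ-fromℕ< x<N′))
... | no  x≮N  = ⊥-elim (x≮N x<N)

member-≥ : ∀ {N} (I : Subset N) x → ¬ x < N → member I x ≡ false
member-≥ {N} I x x≮N with x <? N
... | yes x<N = ⊥-elim (x≮N x<N)
... | no  _   = refl

next : (ℕ → ℕ → Bool) → ℕ → ℕ → ℕ
next F h j = if F h (suc j) then suc h else pred h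

greedy : (ℕ → ℕ → Bool) → ℕ → ℕ → ℕ → List ℕ
greedy F h j zero    = []
greedy F h j (suc n) = next F h j ∷ greedy F (next F h j) (suc j) n

Describes : (ℕ → ℕ → Bool) → ℕ → ℕ → List ℕ → Set
Describes F h j p = ∀ i r → i ≤ length p → F r (i + j) ≡ column (heightAt h p i) r

module _ (F : ℕ → ℕ → Bool) where

  describes-cons : ∀ {j h a p} → (∀ r → F r j ≡ column h r) → Describes F a (suc j) p → Describes F h j (a ∷ p)
  describes-cons F₀ D zero        r _       = F₀ r
  describes-cons {j} F₀ D (suc i) r (s≤s i≤) = trans (cong (F r) (sym (+-suc i j))) (D i r i≤)

  describes-tail : ∀ {j h a p} → Describes F h j (a ∷ p) → Describes F a (suc j) p
  describes-tail {j} D i r i≤ = trans (cong (F r) (+-suc i j)) (D (suc i) r (s≤s i≤))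

  next-true : ∀ {h j} → F h (suc j) ≡ true → next F h j ≡ suc h
  next-true eq = cong (if_then _ else _) eq

  next-false : ∀ {h j} → F h (suc j) ≡ false → next F h j ≡ pred h
  next-false eq = cong (if_then _ else _) eq

  next-step : ∀ {h j a} → F h (suc j) ≡ column a h → Step h a → next F h j ≡ a
  next-step {h} eq (inj₁ refl) = next-true (trans eq (column-top h))
  next-step {h} eq (inj₂ refl) = next-false (trans eq (column-≥ (pred h) h pred[n]≤n))

  greedy-recovers : ∀ {n h j p} → p ∈ paths n h → Describes F h j p → greedy F h j n ≡ p
  greedy-recovers {zero} {h} p∈ D with paths-zero {h} p∈
  ... | refl , _ = refl
  greedy-recovers {suc n} {h} p∈ D with paths-suc {n} {h} p∈
  ... | a , p′ , refl , h↝a , p′∈ rewrite next-step (D 1 h (s≤s z≤n)) h↝a =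
    cong (a ∷_) (greedy-recovers p′∈ (describes-tail D))

-- The matrix of a nice order ideal satisfies these hypotheses. They force every
-- column to be column h for some h, the next one then being column (h ± 1).
module Greedy (F : ℕ → ℕ → Bool) (bnd : ℕ)
  (closed-t : ∀ r j → j ≤ bnd → F (suc r) (suc j) ≡ true → F r j ≡ true)
  (closed-s : ∀ r j → j ≤ bnd → F (suc r) j ≡ true → F r (suc j) ≡ true)
  (nice : ∀ r j → F r j ≡ true → F r (suc j) ≡ true → ⊥)
  (last-empty : ∀ r → F r (suc bnd) ≡ false) where

  closed-double : ∀ r j e → j ≤ bnd → F (r + double e) (suc j) ≡ true → F r (suc j) ≡ true
  closed-double r j zero    j≤ x = subst (λ m → F m (suc j) ≡ true) (+-identityʳ r) x
  closed-double r j (suc e) j≤ x = closed-double r j e j≤ (closed-s m j j≤ (closed-t (suc m) j j≤ x′))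
    where
    m : ℕ
    m = r + double e
    x′ : F (suc (suc m)) (suc j) ≡ true
    x′ = subst (λ n → F n (suc j) ≡ true) (trans (+-suc r (suc (double e))) (cong suc (+-suc r (double e)))) x

  next-column-up : ∀ h j → j ≤ bnd → (∀ r → F r j ≡ column h r) → F h (suc j) ≡ true →
                   ∀ r → F r (suc j) ≡ column (suc h) r
  next-column-up h j j≤ Fⱼ Fₕ r = ≡true⇔≡true⇒≡ (to r) (from r)
    where
    to : ∀ r → F r (suc j) ≡ true → column (suc h) r ≡ true
    to zero x with column h zero in c
    ... | true  = ⊥-elim (nice 0 j (trans (Fⱼ 0) c) x)
    ... | false = refl
    to (suc r) x = trans (sym (Fⱼ r)) (closed-t r j j≤ x)
    from : ∀ r → column (suc h) r ≡ true → F r (suc j) ≡ true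
    from r c with column⇒gap h r c
    ... | e , refl = closed-double r j e j≤ Fₕ

  next-column-down : ∀ h j → j ≤ bnd → (∀ r → F r j ≡ column h r) → F h (suc j) ≡ false →
                     ∀ r → F r (suc j) ≡ column (pred h) r
  next-column-down h j j≤ Fⱼ Fₕ r = ≡true⇔≡true⇒≡ (to h Fⱼ Fₕ r) (from h Fⱼ r)
    where
    to : ∀ h → (∀ r → F r j ≡ column h r) → F h (suc j) ≡ false →
         ∀ r → F r (suc j) ≡ true → column (pred h) r ≡ true
    to zero    Fⱼ Fₕ zero    x with trans (sym Fₕ) x
    ... | ()
    to zero    Fⱼ Fₕ (suc r) x with trans (sym (Fⱼ r)) (closed-t r j j≤ x)
    ... | ()
    to (suc h) Fⱼ Fₕ zero    x with column h zero in c
    ... | true  = refl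
    ... | false = ⊥-elim (nice 0 j (trans (Fⱼ 0) (cong not c)) x)
    to (suc h) Fⱼ Fₕ (suc r) x = column-up h r (trans (sym (Fⱼ r)) (closed-t r j j≤ x)) r≢h
      where
      r≢h : r ≢ h
      r≢h refl with trans (sym Fₕ) x
      ... | ()
    from : ∀ h → (∀ r → F r j ≡ column h r) → ∀ r → column (pred h) r ≡ true → F r (suc j) ≡ true
    from (suc h) Fⱼ r c = closed-s r j j≤ (trans (Fⱼ (suc r)) c)

  j≤bnd : ∀ {j n} → j + suc n ≡ suc bnd → j ≤ bnd
  j≤bnd {j} {n} eq = ≤-pred (subst (suc j ≤_) (trans (sym (+-suc j n)) eq) (s≤s (m≤m+n j n)))

  greedy-describes : ∀ n h j → (∀ r → F r j ≡ column h r) → j + n ≡ suc bnd →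
                     greedy F h j n ∈ paths n h × Describes F h j (greedy F h j n)
  greedy-describes zero zero j Fⱼ _ = here refl , λ { zero r _ → Fⱼ r }
  greedy-describes zero (suc h) j Fⱼ j+0≡ = ⊥-elim (true≢false (trans (sym (column-top h)) (trans (sym (Fⱼ h)) Fₕ)))
    where
    true≢false : true ≢ false
    true≢false ()
    Fₕ : F h j ≡ false
    Fₕ = trans (cong (F h) (trans (sym (+-identityʳ j)) j+0≡)) (last-empty h)
  greedy-describes (suc n) h j Fⱼ j+n≡ with F h (suc j) in Fₕ
  ... | true =
    ∈-++⁺ˡ (∈-map⁺ (suc h ∷_) (proj₁ rest)) , describes-cons F Fⱼ (proj₂ rest)
    where
    rest : greedy F (suc h) (suc j) n ∈ paths n (suc h) × Describes F (suc h) (suc j) (greedy F (suc h) (suc j) n)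
    rest = greedy-describes n (suc h) (suc j) (next-column-up h j (j≤bnd j+n≡) Fⱼ Fₕ)
                            (trans (sym (+-suc j n)) j+n≡)
  ... | false =
    ∈-++⁺ʳ (map (suc h ∷_) (paths n (suc h))) (∈-map⁺ (pred h ∷_) (proj₁ rest)) ,
    describes-cons F Fⱼ (proj₂ rest)
    where
    rest : greedy F (pred h) (suc j) n ∈ paths n (pred h) × Describes F (pred h) (suc j) (greedy F (pred h) (suc j) n)
    rest = greedy-describes n (pred h) (suc j) (next-column-down h j (j≤bnd j+n≡) Fⱼ Fₕ)
                            (trans (sym (+-suc j n)) j+n≡)

-- The bijection

module Bijection (k : ℕ) where
  open Grid k

  n₀ : ℕ
  n₀ = suc (2 * k)

  matrix : Subset (Bound k) → ℕ → ℕ → Bool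
  matrix I r j = member I (cell r j)

  columnsOf : List ℕ → ℕ → Bool
  columnsOf p x = column (heightAt 0 p (x % W)) (x / W)

  idealOf : List ℕ → Subset (Bound k)
  idealOf p = tabulate (columnsOf p ∘ toℕ)

  decode : Subset (Bound k) → List ℕ
  decode I = greedy (matrix I) 0 0 n₀

  module OfPath {p : List ℕ} (p∈ : p ∈ paths n₀ 0) where

    height : ℕ → ℕ
    height = heightAt 0 p

    column⇒triangle : ∀ j r → column (height j) r ≡ true → InTriangle r j
    column⇒triangle j r c with paths-column-bound p∈ j r c
    ... | r<j , j+r<n₀ = r<j , ≤-pred j+r<n₀

    matrix-idealOf : ∀ r j → j < W → matrix (idealOf p) r j ≡ column (height j) r
    matrix-idealOf r j j<W = by-bound (cell r j <? Bound k)
      where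
      by-bound : Dec (cell r j < Bound k) → matrix (idealOf p) r j ≡ column (height j) r
      by-bound (yes lt) = trans (member-tabulate (columnsOf p) (cell r j) lt)
        (cong₂ (λ a b → column (height b) a) (proj₁ (cell-coords r j j<W)) (proj₂ (cell-coords r j j<W)))
      by-bound (no ≮) with column (height j) r in c
      ... | true  = ⊥-elim (≮ (triangle-bounded (column⇒triangle j r c)))
      ... | false = member-≥ (idealOf p) (cell r j) ≮

    describes : Describes (matrix (idealOf p)) 0 0 p
    describes i r i≤ = trans (cong (matrix (idealOf p) r) (+-identityʳ i))
      (matrix-idealOf r i (s≤s (≤-trans i≤ (≤-reflexive (paths-length p∈)))))

    ∈idealOf⇒column : ∀ {x} → MemI (idealOf p) x → column (height (x % W)) (x / W) ≡ true
    ∈idealOf⇒column {x} x∈ = trans (sym (matrix-idealOf (x / W) (x % W) (m%n<n x W)))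
      (subst (λ y → member (idealOf p) y ≡ true) (cell-divMod x) (MemI⇒member (idealOf p) x x∈))

    column⇒∈idealOf : ∀ r j → j < W → column (height j) r ≡ true → MemI (idealOf p) (cell r j)
    column⇒∈idealOf r j j<W c = member⇒MemI (idealOf p) (cell r j) (trans (matrix-idealOf r j j<W) c)

    cell-cover-closed : ∀ {x} q j → column (height j) q ≡ true → cell q j ≡ x + s ⊎ cell q j ≡ x + t →
                        MemI (idealOf p) x
    -- Row 0 has nothing below it: its entries are at most 2k < s.
    cell-cover-closed {x} zero j c j≡ = ⊥-elim (1+n≰n (≤-trans (≤-reflexive (+-comm 1 (2 * k)))
      (≤-trans (s≤j j≡) (m+n≤o⇒m≤o j (proj₂ (column⇒triangle j 0 c))))))
      where
      s≤j : j ≡ x + s ⊎ j ≡ x + t → s ≤ j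
      s≤j (inj₁ eq) = subst (s ≤_) (sym eq) (m≤n+m s x)
      s≤j (inj₂ eq) = subst (s ≤_) (sym eq)
        (≤-trans (m≤m+n s 2) (≤-trans (≤-reflexive (+-assoc (2 * k) 1 2)) (m≤n+m t x)))
    cell-cover-closed {x} (suc q) j c (inj₁ eq) =
      subst (MemI (idealOf p)) (+-cancelʳ-≡ s _ _ (trans (sym (cell-+s q j)) eq))
        (column⇒∈idealOf q (suc j) (s≤s (s≤s j≤2k)) (column-step-down q (paths-step p∈ j (s≤s j≤2k)) c))
      where
      j≤2k : j ≤ 2 * k
      j≤2k = m+n≤o⇒m≤o j (proj₂ (column⇒triangle j (suc q) c))
    cell-cover-closed {x} (suc q) (suc j) c (inj₂ eq) =
      subst (MemI (idealOf p)) (+-cancelʳ-≡ t _ _ (trans (sym (cell-+t q j)) eq))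
        (column⇒∈idealOf q j (s≤s (≤-trans j≤2k (n≤1+n _))) (column-step-up q (paths-step p∈ j (s≤s j≤2k)) c))
      where
      j≤2k : j ≤ 2 * k
      j≤2k = ≤-trans (n≤1+n j) (m+n≤o⇒m≤o (suc j) (proj₂ (column⇒triangle (suc j) (suc q) c)))
    cell-cover-closed (suc q) zero c (inj₂ _) with column⇒triangle zero (suc q) c
    ... | () , _

    ⪯-closed : ∀ {x y} → Leq s t x y → MemI (idealOf p) y → MemI (idealOf p) x
    ⪯-closed ε y∈ = y∈
    ⪯-closed (_◅_ {j = z} (_ , _ , z≡) z⪯y) y∈ =
      cell-cover-closed (z / W) (z % W) (∈idealOf⇒column (⪯-closed z⪯y y∈))
        (Sum.map (trans (sym (cell-divMod z))) (trans (sym (cell-divMod z))) z≡)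

    idealOf-nice : IsNice (idealOf p)
    idealOf-nice x y x∈ y∈ x≡y+1 =
      column-step-disjoint (y / W) (paths-step p∈ j (s≤s j≤2k)) cy
        (subst₂ (λ q i → column (height i) q ≡ true) (proj₁ coords) (proj₂ coords) cx)
      where
      j : ℕ
      j = y % W
      cy : column (height j) (y / W) ≡ true
      cy = ∈idealOf⇒column y∈
      cx : column (height (x % W)) (x / W) ≡ true
      cx = ∈idealOf⇒column x∈
      j≤2k : j ≤ 2 * k
      j≤2k = m+n≤o⇒m≤o j (proj₂ (column⇒triangle j (y / W) cy))
      coords : x / W ≡ y / W × x % W ≡ suc j
      coords = cell-injective (m%n<n x W) (s≤s (s≤s j≤2k))
        (trans (sym (cell-divMod x)) (trans x≡y+1 (trans (cong (_+ 1) (cell-divMod y)) (sym (cell-+1 (y / W) j)))))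

    idealOf-niceIdeal : IsNiceOrderIdealM k (idealOf p)
    idealOf-niceIdeal = (∈⇒M , λ x y y∈ _ x⪯y → ⪯-closed x⪯y y∈) , idealOf-nice
      where
      ∈⇒M : ∀ x → MemI (idealOf p) x → InM k x
      ∈⇒M x x∈ = subst (InM k) (sym (cell-divMod x))
        (triangle⇒InM (column⇒triangle (x % W) (x / W) (∈idealOf⇒column x∈)))

  module OfIdeal {I : Subset (Bound k)} (I-nice : IsNiceOrderIdealM k I) where

    F : ℕ → ℕ → Bool
    F = matrix I

    F⇒triangle : ∀ r j → j < W → F r j ≡ true → InTriangle r j
    F⇒triangle r j j<W Frj = subst₂ InTriangle (proj₁ coords) (proj₂ coords)
      (InM⇒triangle (proj₁ (proj₁ I-nice) (cell r j) (member⇒MemI I (cell r j) Frj)))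
      where
      coords : cell r j / W ≡ r × cell r j % W ≡ j
      coords = cell-coords r j j<W

    F-closed : ∀ {r j r′ j′} → InTriangle r j → InTriangle r′ j′ →
               cell r′ j′ ≡ cell r j + s ⊎ cell r′ j′ ≡ cell r j + t → F r′ j′ ≡ true → F r j ≡ true
    F-closed {r} {j} {r′} {j′} T T′ covers F′ = MemI⇒member I (cell r j)
      (proj₂ (proj₁ I-nice) (cell r j) (cell r′ j′) (member⇒MemI I (cell r′ j′) F′) (triangle⇒InM T)
        ((proj₁ (triangle⇒InM T) , proj₁ (triangle⇒InM T′) , covers) ◅ ε))

    closed-t : ∀ r j → j ≤ 2 * k → F (suc r) (suc j) ≡ true → F r j ≡ true
    closed-t r j j≤2k F′ = F-closed T T′ (inj₂ (cell-+t r j)) F′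
      where
      T′ : InTriangle (suc r) (suc j)
      T′ = F⇒triangle (suc r) (suc j) (s≤s (s≤s j≤2k)) F′
      T : InTriangle r j
      T = ≤-pred (proj₁ T′) , ≤-trans (+-monoʳ-≤ j (n≤1+n r)) (≤-trans (n≤1+n _) (proj₂ T′))

    closed-s : ∀ r j → j ≤ 2 * k → F (suc r) j ≡ true → F r (suc j) ≡ true
    closed-s r j j≤2k F′ = F-closed T T′ (inj₁ (cell-+s r j)) F′
      where
      T′ : InTriangle (suc r) j
      T′ = F⇒triangle (suc r) j (s≤s (≤-trans j≤2k (n≤1+n _))) F′
      T : InTriangle r (suc j)
      T = ≤-trans (n≤1+n (suc r)) (≤-trans (proj₁ T′) (n≤1+n j)) ,
          ≤-trans (≤-reflexive (sym (+-suc j r))) (proj₂ T′)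

    F-nice : ∀ r j → F r j ≡ true → F r (suc j) ≡ true → ⊥
    F-nice r j F₀ F₁ = proj₂ I-nice (cell r (suc j)) (cell r j)
      (member⇒MemI I (cell r (suc j)) F₁) (member⇒MemI I (cell r j) F₀) (cell-+1 r j)

    F-last : ∀ r → F r (suc (2 * k)) ≡ false
    F-last r with F r (suc (2 * k)) in Fr
    ... | true  = ⊥-elim (1+n≰n (m+n≤o⇒m≤o (suc (2 * k)) (proj₂ (F⇒triangle r (suc (2 * k)) ≤-refl Fr))))
    ... | false = refl

    F-first : ∀ r → F r 0 ≡ column 0 r
    F-first r with F r 0 in Fr
    ... | true with () ← proj₁ (F⇒triangle r 0 (s≤s z≤n) Fr)
    ... | false = refl

    open Greedy F (2 * k) closed-t closed-s F-nice F-last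

    decoded : decode I ∈ paths n₀ 0 × Describes F 0 0 (decode I)
    decoded = greedy-describes n₀ 0 0 F-first refl

    idealOf-decode : idealOf (decode I) ≡ I
    idealOf-decode = trans (tabulate-cong pointwise) (tabulate∘lookup I)
      where
      pointwise : ∀ i → columnsOf (decode I) (toℕ i) ≡ lookup I i
      pointwise i = sym (begin
        lookup I i                             ≡⟨ member-toℕ I i ⟨
        member I x                             ≡⟨ cong (member I) (cell-divMod x) ⟩
        F (x / W) (x % W)                      ≡⟨ cong (F (x / W)) (+-identityʳ (x % W)) ⟨
        F (x / W) (x % W + 0)                  ≡⟨ proj₂ decoded (x % W) (x / W) x%W≤ ⟩
        column (heightAt 0 (decode I) (x % W)) (x / W) ∎)
        where
        open ≡-Reasoning
        x : ℕ
        x = toℕ i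
        x%W≤ : x % W ≤ length (decode I)
        x%W≤ = ≤-trans (≤-pred (m%n<n x W)) (≤-reflexive (sym (paths-length (proj₁ decoded))))

  decode-idealOf : ∀ {p} → p ∈ paths n₀ 0 → decode (idealOf p) ≡ p
  decode-idealOf {p} p∈ = greedy-recovers (matrix (idealOf p)) p∈ (OfPath.describes p∈)

  niceIdeals : List (Subset (Bound k))
  niceIdeals = map idealOf (paths n₀ 0)

  niceIdeals-unique : Unique niceIdeals
  niceIdeals-unique = Unique-map-retraction idealOf decode (All.tabulate decode-idealOf) (paths-unique n₀ 0)

  ∈niceIdeals⇔ : ∀ I → I ∈ niceIdeals ⇔ IsNiceOrderIdealM k I
  ∈niceIdeals⇔ I = mk⇔ to from
    where
    to : I ∈ niceIdeals → IsNiceOrderIdealM k I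
    to I∈ with ∈-map⁻ idealOf I∈
    ... | p , p∈ , refl = OfPath.idealOf-niceIdeal p∈
    from : IsNiceOrderIdealM k I → I ∈ niceIdeals
    from I-nice = subst (_∈ niceIdeals) (OfIdeal.idealOf-decode I-nice) (∈-map⁺ idealOf (proj₁ (OfIdeal.decoded I-nice)))

  length-niceIdeals : length niceIdeals ≡ formula k
  length-niceIdeals = begin
    length niceIdeals          ≡⟨ length-map idealOf (paths n₀ 0) ⟩
    #paths (suc (2 * k)) 0     ≡⟨ cong (λ n → #paths (suc n) 0) (double≡2* k) ⟨
    #paths (suc (double k)) 0  ≡⟨ #paths≡formula k ⟩
    formula k                  ∎
    where open ≡-Reasoning

theorem4 : (k : ℕ) → HasCount (IsNiceOrderIdealM k) (formula k)
theorem4 k = niceIdeals , niceIdeals-unique , ∈niceIdeals⇔ , length-niceIdeals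
  where open Bijection k
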